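{- For all integers $n\ge1$ and $k\ge1$, the number of 1-ball prime passing patterns of period $n$ with $k$ hands is $$P'(1,n,k)=\sum_{h=1}^k\binom kh\binom{n-1}{h-1}(h-1)!.$$
   Context: A $b$-ball passing state with $k$ hands is a $k\times\infty$ matrix $A=(a_{i,j})_{1\le i\le k,\,j\ge1}$ with entries in $\{0,1\}$, finitely many nonzero, whose entries sum to $b$; $a_{i,j}=1$ means a ball is scheduled to land at hand $i$ in $j$ beats. There is a transition $A\to B$ iff $a_{i,j+1}\le b_{i,j}$ for all $i$ and all $j\ge1$. A prime passing pattern of period $n$ is a directed cycle of length $n$ in this graph (a closed walk of length $n$ visiting $n$ distinct states), counted up to cyclic rotation. $P'(b,n,k)$ denotes the number of such patterns. -}

module Defs where

open import Data.Nat using (ℕ; zero; suc; _+_; _*_; _∸_; _≤_; _<_; _!)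
open import Data.Nat.Combinatorics using (_C_)
open import Data.Bool using (Bool; true; false)
import Data.Bool as B
open import Data.Fin using (Fin)
open import Data.List using (List; map; allFin; upTo)
open import Data.Nat.ListAction using (sum)
open import Data.Product using (Σ; ∃; _×_)
open import Relation.Binary.PropositionalEquality using (_≡_)

b2n : Bool → ℕ
b2n false = 0
b2n true  = 1

rowCount : (ℕ → Bool) → ℕ → ℕ
rowCount r zero    = 0
rowCount r (suc N) = b2n (r N) + rowCount r N

-- Column index j : ℕ encodes beat  j + 1
-- (i.e. 'ball i j' is the paper's a_{i,j+1}); hands are Fin k.
record State (b k : ℕ) : Set where
  field
    ball   : Fin k → ℕ → Bool
    bound  : ℕ
    beyond : ∀ i j → bound ≤ j → ball i j ≡ false
    total  : sum (map (λ i → rowCount (ball i) bound) (allFin k)) ≡ b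
open State public

_≈ₛ_ : ∀ {b k} → State b k → State b k → Set
A ≈ₛ B = ∀ i j → ball A i j ≡ ball B i j

_⟶_ : ∀ {b k} → State b k → State b k → Set
A ⟶ B = ∀ i j → ball A i (suc j) B.≤ ball B i j

-- A directed cycle of length n (a closed walk of length n visiting n distinct
-- states), presented as its n-periodic unrolling  t ↦ A t.
record Cycle (b n k : ℕ) : Set where
  field
    st       : ℕ → State b k
    periodic : ∀ t → st (t + n) ≈ₛ st t
    step     : ∀ t → st t ⟶ st (suc t)
    distinct : ∀ s t → s < n → t < n → st s ≈ₛ st t → s ≡ t
open Cycle public

Rot : ∀ {b n k} → Cycle b n k → Cycle b n k → Set
Rot {b} {n} {k} P Q = Σ ℕ λ r → ∀ t → st P (t + r) ≈ₛ st Q t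

-- "P'(b,n,k) = N": the cycles of length n, counted up to rotation, are
-- exactly N in number (Fin N enumerates the rotation classes bijectively).
PrimePatternCount : (b n k N : ℕ) → Set
PrimePatternCount b n k N =
  Σ (Fin N → Cycle b n k) λ f →
    (∀ c → ∃ λ m → Rot (f m) c) ×
    (∀ m m' → Rot (f m) (f m') → m ≡ m')

-- Σ_{h=1}^k C(k,h) C(n-1,h-1) (h-1)!   (h = suc h', h' = 0 … k-1)
formula : ℕ → ℕ → ℕ
formula n k = sum (map (λ h' → (k C suc h') * (((n ∸ 1) C h') * (h' !))) (upTo k))

{-# OPTIONS --safe #-}
module Submission where

-- A 1-ball state is just the position (a , e) of its ball. From (a , e + 1) the only transition
-- is to (a , e); from a landing position (a , 0) the ball can be thrown to any position. Hence a
-- cycle is a cyclic concatenation of descents (a , e) → (a , e - 1) → … → (a , 0), one for each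
-- throw, and distinct states force distinct hands. Rotating the cycle so that it starts at its
-- least position (least hand, largest height) gives a canonical window: a list of h ≥ 1 throws
-- whose hands are distinct with the least one first, and whose descent lengths e + 1 form a
-- composition of n into h parts. Such windows correspond bijectively to cycles up to rotation,
-- and there are C(k,h) (h-1)! · C(n-1,h-1) of them.

open import Defs
open import Data.Bool using (Bool; true; false; _∧_; T)
import Data.Bool as Bool
open import Data.Bool.Properties using (≤-minimum; ∧-zeroʳ; ∧-identityʳ)
open import Data.Empty using (⊥; ⊥-elim)
open import Data.Fin using (Fin; zero; suc; toℕ; splitAt; join; remQuot; combine; punchIn; punchOut)
import Data.Fin as Fin
import Data.Fin.Properties as Finₚ
open import Data.List
  using (List; []; _∷_; [_]; _++_; map; length; head; upTo; applyUpTo; tabulate; allFin; concatMap; zip; unzip)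
open import Data.List.Properties
  using (map-++; upTo-∷ʳ; length-map; length-++; length-applyUpTo; ∷-injective; ∷-injectiveʳ; map-injective;
         zip-unzip; unzip-zip; map-tabulate; tabulate-cong)
open import Data.List.Relation.Unary.All using (All; []; _∷_; universal)
import Data.List.Relation.Unary.All as All
import Data.List.Relation.Unary.All.Properties as All
open import Data.List.Relation.Unary.AllPairs using ([]; _∷_)
import Data.List.Relation.Unary.AllPairs.Properties as AllPairs
open import Data.List.Relation.Unary.Unique.Propositional using (Unique)
import Data.List.Relation.Unary.Unique.Propositional.Properties as Unique
open import Data.Maybe using (just)
import Data.Maybe.Properties as Maybe
open import Data.Nat
  using (ℕ; zero; suc; pred; _+_; _*_; _∸_; _!; _≤_; _<_; _%_; _/_; _≡ᵇ_; NonZero;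
         z≤n; s≤s; z<s; s<s; s≤s⁻¹)
open import Data.Nat.Combinatorics using (_C_; nCk+nC[k+1]≡[n+1]C[k+1]; nC1≡n; k>n⇒nCk≡0)
open import Data.Nat.DivMod using (m≡m%n+[m/n]*n; [m+kn]%n≡m%n; [m+n]%n≡m%n; m%n<n; m<n⇒m%n≡m; %-distribˡ-+)
open import Data.Nat.ListAction using (sum)
open import Data.Nat.ListAction.Properties using (sum-++)
open import Data.Nat.Properties
open import Data.Product using (Σ; _×_; _,_; proj₁; proj₂)
open import Data.Product.Relation.Binary.Lex.NonStrict using (×-totalOrder)
open import Data.Product.Relation.Binary.Pointwise.NonDependent using (≡×≡⇒≡)
open import Data.Sum using (_⊎_; inj₁; inj₂)
open import Data.Unit using (tt)
open import Function using (_∘_)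
open import Level using (0ℓ)
open import Relation.Binary using (Rel; TotalOrder; DecidableEquality)
import Relation.Binary.Construct.Flip.Ord as Flip
open import Relation.Binary.PropositionalEquality
  using (_≡_; _≢_; refl; sym; trans; cong; cong₂; subst; ≢-sym; module ≡-Reasoning)
open import Relation.Nullary using (¬_; yes; no)
open import Relation.Unary using (Pred; U; _∩_; ∁; _⟨×⟩_; _≐_; Decidable)

-- Enumerations

-- Not an inverse between Fin N and Σ A P: P need not be proof-irrelevant (Unique is not), so
-- index may look at the proof but must return the same index for all of them.
record Enumeration {A : Set} (P : Pred A 0ℓ) (N : ℕ) : Set where
  field
    enum       : Fin N → A
    enum-ok    : ∀ i → P (enum i)
    index      : ∀ a → P a → Fin N
    index-enum : ∀ i p → index (enum i) p ≡ i
    enum-index : ∀ a p → enum (index a p) ≡ a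
open Enumeration public

module _ {A : Set} {P : Pred A 0ℓ} {N : ℕ} (E : Enumeration P N) where

  index-of-enum : ∀ {a} i → a ≡ enum E i → (p : P a) → index E a p ≡ i
  index-of-enum i refl p = index-enum E i p

  enum-injective : ∀ i j → enum E i ≡ enum E j → i ≡ j
  enum-injective i j eq = trans (sym (index-enum E i (enum-ok E i))) (index-of-enum j eq (enum-ok E i))

enumeration-0⇒¬ : ∀ {A} {P : Pred A 0ℓ} → Enumeration P 0 → ∀ {a} → ¬ P a
enumeration-0⇒¬ E {a} p with index E a p
... | ()

≐-enumeration : ∀ {A} {P Q : Pred A 0ℓ} {N} → P ≐ Q → Enumeration P N → Enumeration Q N
≐-enumeration (P⊆Q , Q⊆P) E = record
  { enum       = enum E
  ; enum-ok    = λ i → P⊆Q (enum-ok E i)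
  ; index      = λ a q → index E a (Q⊆P q)
  ; index-enum = λ i q → index-enum E i (Q⊆P q)
  ; enum-index = λ a q → enum-index E a (Q⊆P q)
  }

empty-enumeration : ∀ {A} {P : Pred A 0ℓ} → (∀ {a} → ¬ P a) → Enumeration P 0
empty-enumeration ¬P = record
  { enum       = λ ()
  ; enum-ok    = λ ()
  ; index      = λ _ p → ⊥-elim (¬P p)
  ; index-enum = λ ()
  ; enum-index = λ _ p → ⊥-elim (¬P p)
  }

singleton-enumeration : ∀ {A} {P : Pred A 0ℓ} x → P x → (∀ {a} → P a → a ≡ x) → Enumeration P 1
singleton-enumeration x px unique = record
  { enum       = λ _ → x
  ; enum-ok    = λ _ → px
  ; index      = λ _ _ → zero
  ; index-enum = λ { zero _ → refl }
  ; enum-index = λ _ p → sym (unique p)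
  }

fin-enumeration : ∀ n → Enumeration {Fin n} U n
fin-enumeration n = record
  { enum = λ i → i ; enum-ok = _ ; index = λ i _ → i ; index-enum = λ _ _ → refl ; enum-index = λ _ _ → refl }

module _ {A B : Set} {P : Pred A 0ℓ} {Q : Pred B 0ℓ} {N : ℕ}
         (g : A → B) (g-injective : ∀ a a′ → P a → P a′ → g a ≡ g a′ → a ≡ a′)
         (g-into : ∀ a → P a → Q (g a))
         (g-onto : ∀ b → Q b → Σ A λ a → P a × g a ≡ b) where

  image-enumeration : Enumeration P N → Enumeration Q N
  image-enumeration E = record
    { enum       = λ i → g (enum E i)
    ; enum-ok    = λ i → g-into (enum E i) (enum-ok E i)
    ; index      = λ b q → let (a , p , _) = g-onto b q in index E a p
    ; index-enum = λ i q → let (a , p , ga≡) = g-onto (g (enum E i)) q in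
        index-of-enum E i (g-injective a (enum E i) p (enum-ok E i) ga≡) p
    ; enum-index = λ b q → let (a , p , ga≡) = g-onto b q in trans (cong g (enum-index E a p)) ga≡
    }

module _ {A : Set} {P Q : Pred A 0ℓ} {m n : ℕ} (Q? : Decidable Q)
         (E₁ : Enumeration (P ∩ Q) m) (E₂ : Enumeration (P ∩ ∁ Q) n) where

  private
    choose : Fin m ⊎ Fin n → A
    choose (inj₁ i) = enum E₁ i
    choose (inj₂ j) = enum E₂ j

    choose-ok : ∀ x → P (choose x)
    choose-ok (inj₁ i) = proj₁ (enum-ok E₁ i)
    choose-ok (inj₂ j) = proj₁ (enum-ok E₂ j)

    side : ∀ a → P a → Fin m ⊎ Fin n
    side a p with Q? a
    ... | yes q = inj₁ (index E₁ a (p , q))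
    ... | no ¬q = inj₂ (index E₂ a (p , ¬q))

    side-choose : ∀ x p → side (choose x) p ≡ x
    side-choose (inj₁ i) p with Q? (enum E₁ i)
    ... | yes q = cong inj₁ (index-enum E₁ i (p , q))
    ... | no ¬q = ⊥-elim (¬q (proj₂ (enum-ok E₁ i)))
    side-choose (inj₂ j) p with Q? (enum E₂ j)
    ... | yes q = ⊥-elim (proj₂ (enum-ok E₂ j) q)
    ... | no ¬q = cong inj₂ (index-enum E₂ j (p , ¬q))

    choose-side : ∀ a p → choose (side a p) ≡ a
    choose-side a p with Q? a
    ... | yes q = enum-index E₁ a (p , q)
    ... | no ¬q = enum-index E₂ a (p , ¬q)

  partition-enumeration : Enumeration P (m + n)
  partition-enumeration = record
    { enum       = λ i → choose (splitAt m i)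
    ; enum-ok    = λ i → choose-ok (splitAt m i)
    ; index      = λ a p → join m n (side a p)
    ; index-enum = λ i p → trans (cong (join m n) (side-choose (splitAt m i) p)) (Finₚ.join-splitAt m n i)
    ; enum-index = λ a p → trans (cong choose (Finₚ.splitAt-join m n (side a p))) (choose-side a p)
    }

product-enumeration : ∀ {A B} {P : Pred A 0ℓ} {Q : Pred B 0ℓ} {m n} →
                      Enumeration P m → Enumeration Q n → Enumeration (P ⟨×⟩ Q) (m * n)
product-enumeration {m = m} {n} E₁ E₂ = record
  { enum       = λ i → let (i₁ , i₂) = remQuot {m} n i in enum E₁ i₁ , enum E₂ i₂
  ; enum-ok    = λ i → enum-ok E₁ _ , enum-ok E₂ _
  ; index      = λ { (a , b) (p , q) → combine (index E₁ a p) (index E₂ b q) }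
  ; index-enum = λ { i (p , q) →
      trans (cong₂ combine (index-enum E₁ _ p) (index-enum E₂ _ q)) (Finₚ.combine-remQuot {m} n i) }
  ; enum-index = λ { (a , b) (p , q) → let eq = Finₚ.remQuot-combine (index E₁ a p) (index E₂ b q) in
      cong₂ _,_ (trans (cong (enum E₁ ∘ proj₁) eq) (enum-index E₁ a p))
                (trans (cong (enum E₂ ∘ proj₂) eq) (enum-index E₂ b q)) }
  }

sum-upTo-suc : ∀ (g : ℕ → ℕ) k → sum (map g (upTo (suc k))) ≡ sum (map g (upTo k)) + g k
sum-upTo-suc g k = begin
  sum (map g (upTo (suc k)))        ≡⟨ cong (sum ∘ map g) (upTo-∷ʳ k) ⟨
  sum (map g (upTo k ++ [ k ]))      ≡⟨ cong sum (map-++ g (upTo k) [ k ]) ⟩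
  sum (map g (upTo k) ++ [ g k ])    ≡⟨ sum-++ (map g (upTo k)) [ g k ] ⟩
  sum (map g (upTo k)) + (g k + 0)   ≡⟨ cong (sum (map g (upTo k)) +_) (+-identityʳ (g k)) ⟩
  sum (map g (upTo k)) + g k         ∎
  where open ≡-Reasoning

module _ {A : Set} {P : Pred A 0ℓ} (size : A → ℕ) (g : ℕ → ℕ)
         (E : ∀ j → Enumeration (P ∩ (λ a → size a ≡ j)) (g j)) where

  sum-enumeration : ∀ k → Enumeration (P ∩ (λ a → size a < k)) (sum (map g (upTo k)))
  sum-enumeration zero    = empty-enumeration (λ ())
  sum-enumeration (suc k) =
    subst (Enumeration _) (sym (sum-upTo-suc g k)) (partition-enumeration (λ a → size a <? k) below at)
    where
    below : Enumeration ((P ∩ (λ a → size a < suc k)) ∩ (λ a → size a < k)) (sum (map g (upTo k)))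
    below = ≐-enumeration ((λ (p , s<k) → (p , m<n⇒m<1+n s<k) , s<k) , λ ((p , _) , s<k) → p , s<k)
                          (sum-enumeration k)
    at : Enumeration ((P ∩ (λ a → size a < suc k)) ∩ ∁ (λ a → size a < k)) (g k)
    at = ≐-enumeration ((λ { (p , refl) → (p , ≤-refl) , <-irrefl refl })
                       , λ ((p , s<1+k) , s≮k) → p , ≤-antisym (s≤s⁻¹ s<1+k) (≮⇒≥ s≮k))
                       (E k)

-- Binomial identities

[n+1]C[k+1]*[k+1]≡[n+1]*nCk : ∀ n k → (suc n C suc k) * suc k ≡ suc n * (n C k)
[n+1]C[k+1]*[k+1]≡[n+1]*nCk zero    zero    = refl
[n+1]C[k+1]*[k+1]≡[n+1]*nCk zero    (suc k) = refl
[n+1]C[k+1]*[k+1]≡[n+1]*nCk (suc n) zero    = begin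
  (suc (suc n) C 1) * 1   ≡⟨ *-identityʳ (suc (suc n) C 1) ⟩
  suc (suc n) C 1         ≡⟨ nC1≡n (suc (suc n)) ⟩
  suc (suc n)             ≡⟨ *-identityʳ (suc (suc n)) ⟨
  suc (suc n) * 1         ∎
  where open ≡-Reasoning
[n+1]C[k+1]*[k+1]≡[n+1]*nCk (suc n) (suc k) = begin
  (suc (suc n) C suc (suc k)) * suc (suc k)   ≡⟨ cong (_* suc (suc k)) (nCk+nC[k+1]≡[n+1]C[k+1] (suc n) (suc k)) ⟨
  (a + d) * suc (suc k)                       ≡⟨ *-distribʳ-+ (suc (suc k)) a d ⟩
  a * suc (suc k) + d * suc (suc k)           ≡⟨ cong₂ _+_ a*[k+2] ([n+1]C[k+1]*[k+1]≡[n+1]*nCk n (suc k)) ⟩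
  (a + suc n * (n C k)) + suc n * (n C suc k) ≡⟨ +-assoc a _ _ ⟩
  a + (suc n * (n C k) + suc n * (n C suc k)) ≡⟨ cong (a +_) (*-distribˡ-+ (suc n) (n C k) (n C suc k)) ⟨
  a + suc n * (n C k + n C suc k)             ≡⟨ cong (λ x → a + suc n * x) (nCk+nC[k+1]≡[n+1]C[k+1] n k) ⟩
  a + suc n * a                               ∎
  where
  open ≡-Reasoning
  a d : ℕ
  a = suc n C suc k
  d = suc n C suc (suc k)
  a*[k+2] : a * suc (suc k) ≡ a + suc n * (n C k)
  a*[k+2] = trans (*-comm a (suc (suc k)))
                  (cong (a +_) (trans (*-comm (suc k) a) ([n+1]C[k+1]*[k+1]≡[n+1]*nCk n k)))

[k+1]*[kCs*s!]≡[k+1]C[s+1]*[s+1]! : ∀ k s → suc k * ((k C s) * s !) ≡ (suc k C suc s) * suc s !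
[k+1]*[kCs*s!]≡[k+1]C[s+1]*[s+1]! k s = begin
  suc k * ((k C s) * s !)             ≡⟨ *-assoc (suc k) (k C s) (s !) ⟨
  (suc k * (k C s)) * s !             ≡⟨ cong (_* s !) ([n+1]C[k+1]*[k+1]≡[n+1]*nCk k s) ⟨
  ((suc k C suc s) * suc s) * s !     ≡⟨ *-assoc (suc k C suc s) (suc s) (s !) ⟩
  (suc k C suc s) * suc s !           ∎
  where open ≡-Reasoning

-- Arrangements and compositions

HeadLeast : ∀ {A : Set} → Rel A 0ℓ → Pred (List A) 0ℓ
HeadLeast _R_ []      = ⊥
HeadLeast _R_ (x ∷ l) = All (x R_) l

Arrangement : ∀ {k} → ℕ → Pred (List (Fin k)) 0ℓ
Arrangement s l = length l ≡ s × Unique l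

LeastFirst : ∀ {k} → ℕ → Pred (List (Fin k)) 0ℓ
LeastFirst s = Arrangement (suc s) ∩ HeadLeast Fin._<_

-- The parts of a composition are stored minus one.
Composition : ℕ → ℕ → Pred (List ℕ) 0ℓ
Composition n h l = length l ≡ h × sum (map suc l) ≡ n

StartsWith : ∀ {A : Set} → A → Pred (List A) 0ℓ
StartsWith x l = head l ≡ just x

startsWith? : ∀ {A : Set} → DecidableEquality A → (x : A) → Decidable (StartsWith x)
startsWith? _≟_ x l = Maybe.≡-dec _≟_ (head l) (just x)

module _ {n : ℕ} {i : Fin (suc n)} where

  punchOutAll : ∀ {l} → All (i ≢_) l → List (Fin n)
  punchOutAll []           = []
  punchOutAll (i≢j ∷ i≢js) = punchOut i≢j ∷ punchOutAll i≢js

  punchIn-punchOutAll : ∀ {l} (i∉l : All (i ≢_) l) → map (punchIn i) (punchOutAll i∉l) ≡ l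
  punchIn-punchOutAll []           = refl
  punchIn-punchOutAll (i≢j ∷ i≢js) = cong₂ _∷_ (Finₚ.punchIn-punchOut i≢j) (punchIn-punchOutAll i≢js)

  punchIn-∉ : ∀ l → All (i ≢_) (map (punchIn i) l)
  punchIn-∉ l = All.map⁺ (universal (λ j → Finₚ.punchInᵢ≢i i j ∘ sym) l)

  map-punchIn-injective : ∀ {l l′} → map (punchIn i) l ≡ map (punchIn i) l′ → l ≡ l′
  map-punchIn-injective = map-injective (Finₚ.punchIn-injective i _ _)

  punchOutAll-arrangement : ∀ {s l} (i∉l : All (i ≢_) l) → Arrangement s l → Arrangement s (punchOutAll i∉l)
  punchOutAll-arrangement i∉l (len , u) =
    trans (sym (length-map (punchIn i) (punchOutAll i∉l))) (trans (cong length (punchIn-punchOutAll i∉l)) len) ,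
    Unique.map⁻ (subst Unique (sym (punchIn-punchOutAll i∉l)) u)

arrangements : ∀ k s → Enumeration {List (Fin k)} (Arrangement s) ((k C s) * s !)
arrangements k       zero    = singleton-enumeration [] (refl , []) λ { {[]} _ → refl }
arrangements zero    (suc s) = empty-enumeration λ { {() ∷ _} }
arrangements (suc k) (suc s) =
  subst (Enumeration _) ([k+1]*[kCs*s!]≡[k+1]C[s+1]*[s+1]! k s)
    (image-enumeration insert insert-injective insert-arrangement insert-onto
      (product-enumeration (fin-enumeration (suc k)) (arrangements k s)))
  where
  Inserted : Pred (Fin (suc k) × List (Fin k)) 0ℓ
  Inserted = U ⟨×⟩ Arrangement s
  insert : Fin (suc k) × List (Fin k) → List (Fin (suc k))
  insert (i , l) = i ∷ map (punchIn i) l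
  insert-injective : ∀ a a′ → Inserted a → Inserted a′ → insert a ≡ insert a′ → a ≡ a′
  insert-injective (i , l) (i′ , l′) _ _ eq with ∷-injective eq
  ... | refl , eq′ = cong (i ,_) (map-punchIn-injective eq′)
  insert-arrangement : ∀ a → Inserted a → Arrangement (suc s) (insert a)
  insert-arrangement (i , l) (_ , len , u) =
    cong suc (trans (length-map (punchIn i) l) len) , punchIn-∉ l ∷ Unique.map⁺ (Finₚ.punchIn-injective i _ _) u
  insert-onto : ∀ l → Arrangement (suc s) l → Σ (Fin (suc k) × List (Fin k)) λ a → Inserted a × insert a ≡ l
  insert-onto (i ∷ l) (len , i∉l ∷ u) =
    (i , punchOutAll i∉l) , (tt , punchOutAll-arrangement i∉l (suc-injective len , u)) ,
    cong (i ∷_) (punchIn-punchOutAll i∉l)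

leastFirstArrangements : ∀ k s → Enumeration (LeastFirst {k} s) ((k C suc s) * s !)
leastFirstArrangements zero    s = empty-enumeration λ { {() ∷ _} }
leastFirstArrangements (suc k) s =
  subst (Enumeration _) count
    (partition-enumeration (startsWith? Finₚ._≟_ zero)
      (image-enumeration (λ l → zero ∷ map suc l)
        (λ _ _ _ _ → map-injective Finₚ.suc-injective ∘ ∷-injectiveʳ) withZero withZero-onto (arrangements k s))
      (image-enumeration (map suc) (λ _ _ _ _ → map-injective Finₚ.suc-injective)
        shifted shifted-onto (leastFirstArrangements k s)))
  where
  count : (k C s) * s ! + (k C suc s) * s ! ≡ (suc k C suc s) * s !
  count = trans (sym (*-distribʳ-+ (s !) (k C s) (k C suc s))) (cong (_* s !) (nCk+nC[k+1]≡[n+1]C[k+1] k s))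
  withZero : ∀ l → Arrangement s l → (LeastFirst s ∩ StartsWith zero) (zero ∷ map suc l)
  withZero l (len , u) =
    ((cong suc (trans (length-map suc l) len) , punchIn-∉ l ∷ Unique.map⁺ Finₚ.suc-injective u) ,
     All.map⁺ (universal (λ _ → z<s) l)) , refl
  withZero-onto : ∀ l → (LeastFirst s ∩ StartsWith zero) l →
                  Σ (List (Fin k)) λ l′ → Arrangement s l′ × zero ∷ map suc l′ ≡ l
  withZero-onto (zero ∷ l) (((len , 0∉l ∷ u) , _) , refl) =
    punchOutAll 0∉l , punchOutAll-arrangement 0∉l (suc-injective len , u) , cong (zero ∷_) (punchIn-punchOutAll 0∉l)
  shifted : ∀ l → LeastFirst s l → (LeastFirst s ∩ ∁ (StartsWith zero)) (map suc l)
  shifted (i ∷ l) ((len , u) , i<l) =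
    ((trans (length-map suc (i ∷ l)) len , Unique.map⁺ Finₚ.suc-injective u) , All.map⁺ (All.map s<s i<l)) , λ ()
  shifted-onto : ∀ l → (LeastFirst s ∩ ∁ (StartsWith zero)) l →
                 Σ (List (Fin k)) λ l′ → LeastFirst s l′ × map suc l′ ≡ l
  shifted-onto (zero ∷ l)  (_ , l≢0∷) = ⊥-elim (l≢0∷ refl)
  shifted-onto (suc i ∷ l) (((len , u) , i<l) , _) =
    punchOutAll 0∉ , (punchOutAll-arrangement 0∉ (len , u) , i<tail) , cong (suc i ∷_) tail≡
    where
    0∉ : All (zero ≢_) (suc i ∷ l)
    0∉ = (λ ()) ∷ All.map (λ { {zero} () refl ; {suc _} _ () }) i<l
    tail≡ : map suc (punchOutAll (All.tail 0∉)) ≡ l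
    tail≡ = punchIn-punchOutAll (All.tail 0∉)
    i<tail : All (i Fin.<_) (punchOutAll (All.tail 0∉))
    i<tail = All.map s≤s⁻¹ (All.map⁻ (subst (All (suc i Fin.<_)) (sym tail≡) i<l))

compositions : ∀ m s → Enumeration (Composition (suc m) (suc s)) (m C s)
compositions m       zero    = singleton-enumeration [ m ] (refl , cong suc (+-identityʳ m))
  λ { {e ∷ []} (_ , sum≡) → cong [_] (suc-injective (trans (sym (+-identityʳ (suc e))) sum≡)) }
compositions zero    (suc s) = empty-enumeration λ { {e ∷ _ ∷ _} (_ , sum≡) → m+1+n≢0 e (suc-injective sum≡) }
compositions (suc m) (suc s) =
  subst (Enumeration _) (nCk+nC[k+1]≡[n+1]C[k+1] m s)
    (partition-enumeration (startsWith? _≟_ 0)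
      (image-enumeration (0 ∷_) (λ _ _ _ _ → ∷-injectiveʳ) prepend prepend-onto (compositions m s))
      (image-enumeration incrementHead incrementHead-injective increment increment-onto (compositions m (suc s))))
  where
  Target Dropped Decremented : Pred (List ℕ) 0ℓ
  Target      = Composition (suc (suc m)) (suc (suc s))
  Dropped     = Composition (suc m) (suc s)
  Decremented = Composition (suc m) (suc (suc s))
  prepend : ∀ l → Dropped l → (Target ∩ StartsWith 0) (0 ∷ l)
  prepend _ (len , sum≡) = (cong suc len , cong suc sum≡) , refl
  prepend-onto : ∀ l → (Target ∩ StartsWith 0) l → Σ (List ℕ) λ l′ → Dropped l′ × 0 ∷ l′ ≡ l
  prepend-onto (0 ∷ l) ((len , sum≡) , refl) = l , (suc-injective len , suc-injective sum≡) , refl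
  incrementHead : List ℕ → List ℕ
  incrementHead []      = []
  incrementHead (e ∷ l) = suc e ∷ l
  incrementHead-injective : ∀ l l′ → Decremented l → Decremented l′ →
                            incrementHead l ≡ incrementHead l′ → l ≡ l′
  incrementHead-injective (e ∷ l) (e′ ∷ l′) _ _ refl = refl
  increment : ∀ l → Decremented l → (Target ∩ ∁ (StartsWith 0)) (incrementHead l)
  increment (e ∷ l) (len , sum≡) = (len , cong suc sum≡) , λ ()
  increment-onto : ∀ l → (Target ∩ ∁ (StartsWith 0)) l →
                   Σ (List ℕ) λ l′ → Decremented l′ × incrementHead l′ ≡ l
  increment-onto (0 ∷ l)     (_ , l≢0∷)         = ⊥-elim (l≢0∷ refl)
  increment-onto (suc e ∷ l) ((len , sum≡) , _) = e ∷ l , (len , suc-injective sum≡) , refl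

-- Ball positions and their descents

-- (a , e) stands for the single 1-entry a_{a,e+1} of a 1-ball state: the ball lands in hand a after e + 1 beats.
Pos : ℕ → Set
Pos K = Fin K × ℕ

infix 4 _↝_ _≤ₚ_

data _↝_ {K : ℕ} : Pos K → Pos K → Set where
  fall  : ∀ {a e} → (a , suc e) ↝ (a , e)
  throw : ∀ {a p} → (a , 0) ↝ p

data Grounded {K : ℕ} : List (Pos K) → Set where
  []     : Grounded []
  landed : ∀ {p} → proj₂ p ≡ 0 → Grounded [ p ]
  _∷_    : ∀ {p q r} → p ↝ q → Grounded (q ∷ r) → Grounded (p ∷ q ∷ r)

-- Hands ascending, then heights descending: the least position of a cycle is the top of a descent.
positionOrder : ℕ → TotalOrder 0ℓ 0ℓ 0ℓ
positionOrder K = ×-totalOrder (Finₚ.≤-decTotalOrder K) (Flip.totalOrder ≤-totalOrder)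

_≤ₚ_ : ∀ {K} → Pos K → Pos K → Set
_≤ₚ_ {K} = TotalOrder._≤_ (positionOrder K)

≤ₚ-refl : ∀ {K} {p : Pos K} → p ≤ₚ p
≤ₚ-refl {K} = TotalOrder.refl (positionOrder K)

≤ₚ-antisym : ∀ {K} {p q : Pos K} → p ≤ₚ q → q ≤ₚ p → p ≡ q
≤ₚ-antisym {K} {p} {q} p≤q q≤p with TotalOrder.antisym (positionOrder K) {p} {q} p≤q q≤p
... | a≡b , e≡f = ≡×≡⇒≡ (a≡b , sym e≡f)

module _ {K : ℕ} {a b : Fin K} {e f : ℕ} where

  hand<⇒≤ₚ : a Fin.< b → (a , e) ≤ₚ (b , f)
  hand<⇒≤ₚ a<b = inj₁ (<⇒≤ a<b , Finₚ.<⇒≢ a<b)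

  ≤ₚ∧hand≢⇒hand< : (a , e) ≤ₚ (b , f) → a ≢ b → a Fin.< b
  ≤ₚ∧hand≢⇒hand< (inj₁ (a≤b , a≢b)) _   = Finₚ.≤∧≢⇒< a≤b a≢b
  ≤ₚ∧hand≢⇒hand< (inj₂ (a≡b , _))   a≢b = ⊥-elim (a≢b a≡b)

height≥⇒≤ₚ : ∀ {K} {a : Fin K} {e f} → f ≤ e → (a , e) ≤ₚ (a , f)
height≥⇒≤ₚ f≤e = inj₂ (refl , f≤e)

fall-≰ₚ : ∀ {K} {a : Fin K} {e} → ¬ (a , e) ≤ₚ (a , suc e)
fall-≰ₚ (inj₁ (_ , a≢a))   = a≢a refl
fall-≰ₚ (inj₂ (_ , 1+e≤e)) = 1+n≰n 1+e≤e

landed⇒↝ : ∀ {K} {p q : Pos K} → proj₂ p ≡ 0 → p ↝ q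
landed⇒↝ {p = a , zero} refl = throw

↝∧≤ₚ⇒landed : ∀ {K} {p q : Pos K} → p ↝ q → q ≤ₚ p → proj₂ p ≡ 0
↝∧≤ₚ⇒landed fall  q≤p = ⊥-elim (fall-≰ₚ q≤p)
↝∧≤ₚ⇒landed throw _   = refl

unique-++⁻ʳ : ∀ {A : Set} (xs : List A) {ys} → Unique (xs ++ ys) → Unique ys
unique-++⁻ʳ []       u       = u
unique-++⁻ʳ (x ∷ xs) (_ ∷ u) = unique-++⁻ʳ xs u

module _ {K : ℕ} where

  descent below : Pos K → List (Pos K)
  descent p = p ∷ below p
  below (a , zero)  = []
  below (a , suc e) = descent (a , e)

  flatten : List (Pos K) → List (Pos K)
  flatten = concatMap descent

  -- The positions that start a descent: the first one and every one that follows a landing.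
  throws : List (Pos K) → List (Pos K)
  afterLanding : Pos K → List (Pos K) → List (Pos K)
  throws []      = []
  throws (p ∷ r) = p ∷ afterLanding p r
  afterLanding (a , zero)  r       = throws r
  afterLanding (a , suc e) []      = []
  afterLanding (a , suc e) (q ∷ r) = afterLanding q r

  afterLanding-below : ∀ p r → afterLanding p (below p ++ r) ≡ throws r
  afterLanding-below (a , zero)  r = refl
  afterLanding-below (a , suc e) r = afterLanding-below (a , e) r

  throws-flatten : ∀ ts → throws (flatten ts) ≡ ts
  throws-flatten []       = refl
  throws-flatten (p ∷ ts) = cong (p ∷_) (trans (afterLanding-below p (flatten ts)) (throws-flatten ts))

  below-afterLanding : ∀ {p r} → Grounded (p ∷ r) → below p ++ flatten (afterLanding p r) ≡ r
  below-afterLanding {a , zero} (landed refl) = refl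
  below-afterLanding (throw ∷ g) = cong (_ ∷_) (below-afterLanding g)
  below-afterLanding (fall ∷ g)  = cong (_ ∷_) (below-afterLanding g)

  flatten-throws : ∀ {W} → Grounded W → flatten (throws W) ≡ W
  flatten-throws {[]}    _ = refl
  flatten-throws {p ∷ r} g = cong (p ∷_) (below-afterLanding g)

  grounded-descent-++ : ∀ p {r} → Grounded r → Grounded (descent p ++ r)
  grounded-descent-++ (a , zero)  []           = landed refl
  grounded-descent-++ (a , zero)  g@(landed _) = throw ∷ g
  grounded-descent-++ (a , zero)  g@(_ ∷ _)    = throw ∷ g
  grounded-descent-++ (a , suc e) g            = fall ∷ grounded-descent-++ (a , e) g

  grounded-flatten : ∀ ts → Grounded (flatten ts)
  grounded-flatten []       = []
  grounded-flatten (p ∷ ts) = grounded-descent-++ p (grounded-flatten ts)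

  length-descent : ∀ p → length (descent p) ≡ suc (proj₂ p)
  length-descent (a , zero)  = refl
  length-descent (a , suc e) = cong suc (length-descent (a , e))

  length-flatten : ∀ ts → length (flatten ts) ≡ sum (map suc (map proj₂ ts))
  length-flatten []       = refl
  length-flatten (p ∷ ts) = trans (length-++ (descent p)) (cong₂ _+_ (length-descent p) (length-flatten ts))

  descent-bounds : ∀ a e → All (λ q → proj₁ q ≡ a × proj₂ q ≤ e) (descent (a , e))
  descent-bounds a zero    = (refl , z≤n) ∷ []
  descent-bounds a (suc e) = (refl , ≤-refl) ∷ All.map (λ (h , le) → h , m≤n⇒m≤1+n le) (descent-bounds a e)

  descent-landing : ∀ {P : Pred (Pos K) 0ℓ} p → All P (descent p) → P (proj₁ p , 0)
  descent-landing (a , zero)  (Pp ∷ _)  = Pp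
  descent-landing (a , suc e) (_ ∷ Pps) = descent-landing (a , e) Pps

  unique-descent : ∀ p → Unique (descent p)
  unique-descent (a , zero)  = [] ∷ []
  unique-descent (a , suc e) =
    All.map (λ (_ , le) eq → 1+n≰n (subst (_≤ e) (sym (cong proj₂ eq)) le)) (descent-bounds a e)
    ∷ unique-descent (a , e)

  flatten-hands : ∀ {P : Pred (Fin K) 0ℓ} {ts} → All (P ∘ proj₁) ts → All (P ∘ proj₁) (flatten ts)
  flatten-hands {ts = []}           []         = []
  flatten-hands {P} {(a , e) ∷ ts} (Pa ∷ Pts) =
    All.++⁺ (All.map (λ (a≡ , _) → subst P (sym a≡) Pa) (descent-bounds a e)) (flatten-hands Pts)

  flatten-landings : ∀ {P : Pred (Pos K) 0ℓ} ts → All P (flatten ts) → All (λ t → P (proj₁ t , 0)) ts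
  flatten-landings []       []  = []
  flatten-landings (t ∷ ts) Pts =
    let (Pt , Pts′) = All.++⁻ (descent t) Pts in descent-landing t Pt ∷ flatten-landings ts Pts′

  unique-flatten : ∀ {ts} → Unique (map proj₁ ts) → Unique (flatten ts)
  unique-flatten {[]}           []          = []
  unique-flatten {(a , e) ∷ ts} (a∉ ∷ uts) =
    AllPairs.++⁺ (unique-descent (a , e)) (unique-flatten uts)
      (All.map (λ (a≡ , _) → All.map (λ a≢ eq → a≢ (trans (sym a≡) (cong proj₁ eq))) others)
               (descent-bounds a e))
    where
    others : All ((a ≢_) ∘ proj₁) (flatten ts)
    others = flatten-hands (All.map⁻ a∉)

  landing-∉ : ∀ p {r} → Unique (descent p ++ r) → All ((proj₁ p , 0) ≢_) r
  landing-∉ (a , zero)  (a∉ ∷ _) = a∉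
  landing-∉ (a , suc e) (_ ∷ u)  = landing-∉ (a , e) u

  unique-flatten⁻ : ∀ ts → Unique (flatten ts) → Unique (map proj₁ ts)
  unique-flatten⁻ []       _ = []
  unique-flatten⁻ (t ∷ ts) u =
    All.map⁺ (All.map (λ ne eq → ne (cong (_, 0) eq)) (flatten-landings ts (landing-∉ t u)))
    ∷ unique-flatten⁻ ts (unique-++⁻ʳ (descent t) u)

  headLeast-flatten : ∀ {ts} → HeadLeast Fin._<_ (map proj₁ ts) → HeadLeast _≤ₚ_ (flatten ts)
  headLeast-flatten {(a , e) ∷ ts} a<ts =
    All.++⁺ (All.map (λ { {b , f} (refl , f≤e) → height≥⇒≤ₚ f≤e }) (All.tail (descent-bounds a e)))
            (All.map hand<⇒≤ₚ (flatten-hands (All.map⁻ a<ts)))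

  all-throws : ∀ {P : Pred (Pos K) 0ℓ} {W} → All P W → All P (throws W)
  all-afterLanding : ∀ {P : Pred (Pos K) 0ℓ} p {r} → All P r → All P (afterLanding p r)
  all-throws []                      = []
  all-throws {W = p ∷ r} (Pp ∷ Pr)   = Pp ∷ all-afterLanding p Pr
  all-afterLanding (a , zero)  Pr                = all-throws Pr
  all-afterLanding (a , suc e) {[]}    []        = []
  all-afterLanding (a , suc e) {q ∷ r} (_ ∷ Pr) = all-afterLanding q Pr

  headLeast-throws : ∀ {W} → Unique (map proj₁ (throws W)) → HeadLeast _≤ₚ_ W →
                     HeadLeast Fin._<_ (map proj₁ (throws W))
  headLeast-throws {p ∷ r} (p∉ ∷ _) p≤r =
    All.map⁺ (All.zipWith (λ (p≤q , p≢q) → ≤ₚ∧hand≢⇒hand< p≤q p≢q)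
                          (all-afterLanding p p≤r , All.map⁻ p∉))

-- Canonical throw lists and canonical windows

unzip≡map-proj : ∀ {A B : Set} (ts : List (A × B)) → unzip ts ≡ (map proj₁ ts , map proj₂ ts)
unzip≡map-proj []       = refl
unzip≡map-proj (t ∷ ts) = cong (λ (xs , ys) → proj₁ t ∷ xs , proj₂ t ∷ ys) (unzip≡map-proj ts)

map-proj-zip : ∀ {A B : Set} (xs : List A) (ys : List B) → length xs ≡ length ys →
               (map proj₁ (zip xs ys) , map proj₂ (zip xs ys)) ≡ (xs , ys)
map-proj-zip xs ys len = trans (sym (unzip≡map-proj (zip xs ys))) (unzip-zip xs ys len)

zip-map-proj : ∀ {A B : Set} (ts : List (A × B)) → zip (map proj₁ ts) (map proj₂ ts) ≡ ts
zip-map-proj ts = trans (cong (λ (xs , ys) → zip xs ys) (sym (unzip≡map-proj ts))) (zip-unzip ts)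

CanonicalThrows : ∀ {K} → ℕ → Pred (List (Pos K)) 0ℓ
CanonicalThrows n ts =
  (Unique (map proj₁ ts) × HeadLeast Fin._<_ (map proj₁ ts)) × sum (map suc (map proj₂ ts)) ≡ n

canonicalThrowsOfLength : ∀ m K j →
  Enumeration (CanonicalThrows {K} (suc m) ∩ (λ ts → pred (length ts) ≡ j)) ((K C suc j) * ((m C j) * j !))
canonicalThrowsOfLength m K j =
  subst (Enumeration _) count
    (image-enumeration (λ (hs , es) → zip hs es) zip-injective zip-into zip-onto
      (product-enumeration (leastFirstArrangements K j) (compositions m j)))
  where
  count : ((K C suc j) * j !) * (m C j) ≡ (K C suc j) * ((m C j) * j !)
  count = trans (*-assoc (K C suc j) (j !) (m C j)) (cong ((K C suc j) *_) (*-comm (j !) (m C j)))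
  Pairs : Pred (List (Fin K) × List ℕ) 0ℓ
  Pairs = LeastFirst j ⟨×⟩ Composition (suc m) (suc j)
  Throws : Pred (List (Pos K)) 0ℓ
  Throws = CanonicalThrows (suc m) ∩ (λ ts → pred (length ts) ≡ j)
  lengths : ∀ hs es → Pairs (hs , es) → length hs ≡ length es
  lengths _ _ (((len , _) , _) , (len′ , _)) = trans len (sym len′)
  zip-injective : ∀ a a′ → Pairs a → Pairs a′ →
                  zip (proj₁ a) (proj₂ a) ≡ zip (proj₁ a′) (proj₂ a′) → a ≡ a′
  zip-injective (hs , es) (hs′ , es′) p p′ eq =
    trans (sym (map-proj-zip hs es (lengths hs es p)))
          (trans (cong (λ ts → map proj₁ ts , map proj₂ ts) eq) (map-proj-zip hs′ es′ (lengths hs′ es′ p′)))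
  zip-into : ∀ a → Pairs a → Throws (zip (proj₁ a) (proj₂ a))
  zip-into (hs , es) p@(((len , u) , hl) , (_ , sum≡)) =
    subst (λ (xs , ys) → (Unique xs × HeadLeast Fin._<_ xs) × sum (map suc ys) ≡ suc m) (sym eq) ((u , hl) , sum≡) ,
    cong pred (trans (sym (length-map proj₁ (zip hs es))) (trans (cong (length ∘ proj₁) eq) len))
    where
    eq : (map proj₁ (zip hs es) , map proj₂ (zip hs es)) ≡ (hs , es)
    eq = map-proj-zip hs es (lengths hs es p)
  zip-onto : ∀ ts → Throws ts → Σ (List (Fin K) × List ℕ) λ a → Pairs a × zip (proj₁ a) (proj₂ a) ≡ ts
  zip-onto (t ∷ ts) (((u , hl) , sum≡) , refl) =
    (map proj₁ (t ∷ ts) , map proj₂ (t ∷ ts)) ,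
    (((cong suc (length-map proj₁ ts) , u) , hl) , (cong suc (length-map proj₂ ts) , sum≡)) , zip-map-proj (t ∷ ts)

-- A canonical throw list with more than K throws would be counted by C(K, j + 1) = 0.
canonicalThrows-pred-length< : ∀ {m K ts} → CanonicalThrows {K} (suc m) ts → pred (length ts) < K
canonicalThrows-pred-length< {m} {K} {ts} t with pred (length ts) <? K
... | yes j<K = j<K
... | no  j≮K = ⊥-elim (enumeration-0⇒¬ (subst (Enumeration _) vanishes (canonicalThrowsOfLength m K j)) (t , refl))
  where
  j : ℕ
  j = pred (length ts)
  vanishes : (K C suc j) * ((m C j) * j !) ≡ 0
  vanishes = cong (_* ((m C j) * j !)) (k>n⇒nCk≡0 (s≤s (≮⇒≥ j≮K)))

canonicalThrowsEnumeration : ∀ m K → Enumeration (CanonicalThrows {K} (suc m)) (formula (suc m) K)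
canonicalThrowsEnumeration m K =
  ≐-enumeration (proj₁ , λ t → t , canonicalThrows-pred-length< t)
    (sum-enumeration (pred ∘ length) (λ j → (K C suc j) * ((m C j) * j !)) (canonicalThrowsOfLength m K) K)

CanonicalWindow : ∀ {K} → ℕ → Pred (List (Pos K)) 0ℓ
CanonicalWindow n W = length W ≡ n × Unique W × Grounded W × HeadLeast _≤ₚ_ W

canonicalWindowEnumeration : ∀ m K → Enumeration (CanonicalWindow {K} (suc m)) (formula (suc m) K)
canonicalWindowEnumeration m K =
  image-enumeration flatten flatten-injective flatten-canonical throws-canonical (canonicalThrowsEnumeration m K)
  where
  flatten-injective : ∀ ts ts′ → CanonicalThrows (suc m) ts → CanonicalThrows (suc m) ts′ →
                      flatten ts ≡ flatten ts′ → ts ≡ ts′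
  flatten-injective ts ts′ _ _ eq = trans (sym (throws-flatten ts)) (trans (cong throws eq) (throws-flatten ts′))
  flatten-canonical : ∀ ts → CanonicalThrows (suc m) ts → CanonicalWindow (suc m) (flatten ts)
  flatten-canonical ts ((u , hl) , sum≡) =
    trans (length-flatten ts) sum≡ , unique-flatten u , grounded-flatten ts , headLeast-flatten hl
  throws-canonical : ∀ W → CanonicalWindow (suc m) W →
                     Σ (List (Pos K)) λ ts → CanonicalThrows (suc m) ts × flatten ts ≡ W
  throws-canonical W (len , u , g , hl) = throws W , ((u′ , headLeast-throws u′ hl) , sum≡) , flatten-throws g
    where
    u′ : Unique (map proj₁ (throws W))
    u′ = unique-flatten⁻ (throws W) (subst Unique (sym (flatten-throws g)) u)
    sum≡ : sum (map suc (map proj₂ (throws W))) ≡ suc m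
    sum≡ = trans (sym (length-flatten (throws W))) (trans (cong length (flatten-throws g)) len)

-- Orbits: periodic sequences of positions

module _ (n : ℕ) .{{_ : NonZero n}} where

  %-cong-+ : ∀ x y d → x % n ≡ y % n → (x + d) % n ≡ (y + d) % n
  %-cong-+ x y d eq = begin
    (x + d) % n               ≡⟨ %-distribˡ-+ x d n ⟩
    (x % n + d % n) % n       ≡⟨ cong (λ z → (z + d % n) % n) eq ⟩
    (y % n + d % n) % n       ≡⟨ %-distribˡ-+ y d n ⟨
    (y + d) % n               ∎
    where open ≡-Reasoning

  +-%-cancelˡ : ∀ l {i j} → i < n → j < n → (l + i) % n ≡ (l + j) % n → i ≡ j
  +-%-cancelˡ l {i} {j} i<n j<n eq = begin
    i                           ≡⟨ m<n⇒m%n≡m i<n ⟨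
    i % n                       ≡⟨ [m+kn]%n≡m%n i l n ⟨
    (i + l * n) % n             ≡⟨ cong (_% n) (rearrange i) ⟨
    (l + i + (l * n ∸ l)) % n   ≡⟨ %-cong-+ (l + i) (l + j) (l * n ∸ l) eq ⟩
    (l + j + (l * n ∸ l)) % n   ≡⟨ cong (_% n) (rearrange j) ⟩
    (j + l * n) % n             ≡⟨ [m+kn]%n≡m%n j l n ⟩
    j % n                       ≡⟨ m<n⇒m%n≡m j<n ⟩
    j                           ∎
    where
    open ≡-Reasoning
    rearrange : ∀ x → l + x + (l * n ∸ l) ≡ x + l * n
    rearrange x = begin
      l + x + (l * n ∸ l)       ≡⟨ cong (_+ (l * n ∸ l)) (+-comm l x) ⟩
      x + l + (l * n ∸ l)       ≡⟨ +-assoc x l _ ⟩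
      x + (l + (l * n ∸ l))     ≡⟨ cong (x +_) (m+[n∸m]≡n (m≤m*n l n)) ⟩
      x + l * n                 ∎

  suc-% : ∀ t → suc (t % n) < n → suc t % n ≡ suc (t % n)
  suc-% t lt = begin
    suc t % n                          ≡⟨ cong (λ x → suc x % n) (m≡m%n+[m/n]*n t n) ⟩
    (suc (t % n) + (t / n) * n) % n    ≡⟨ [m+kn]%n≡m%n (suc (t % n)) (t / n) n ⟩
    suc (t % n) % n                    ≡⟨ m<n⇒m%n≡m lt ⟩
    suc (t % n)                        ∎
    where open ≡-Reasoning

applyUpTo-cong : ∀ {A : Set} {f g : ℕ → A} k → (∀ i → i < k → f i ≡ g i) → applyUpTo f k ≡ applyUpTo g k
applyUpTo-cong zero    _  = refl
applyUpTo-cong (suc k) eq = cong₂ _∷_ (eq 0 z<s) (applyUpTo-cong k (λ i i<k → eq (suc i) (s<s i<k)))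

lookupOr : ∀ {A : Set} → A → List A → ℕ → A
lookupOr d []       _       = d
lookupOr d (x ∷ xs) zero    = x
lookupOr d (x ∷ xs) (suc i) = lookupOr d xs i

module _ {A : Set} (d : A) where

  lookupOr-applyUpTo : ∀ (f : ℕ → A) {k i} → i < k → lookupOr d (applyUpTo f k) i ≡ f i
  lookupOr-applyUpTo f {suc k} {zero}  _         = refl
  lookupOr-applyUpTo f {suc k} {suc i} (s<s i<k) = lookupOr-applyUpTo (f ∘ suc) i<k

  applyUpTo-lookupOr : ∀ xs → applyUpTo (lookupOr d xs) (length xs) ≡ xs
  applyUpTo-lookupOr []       = refl
  applyUpTo-lookupOr (x ∷ xs) = cong (x ∷_) (applyUpTo-lookupOr xs)

  lookupOr-∈ : ∀ {P : A → Set} {xs i} → All P xs → i < length xs → P (lookupOr d xs i)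
  lookupOr-∈ {i = zero}  (px ∷ _)  _         = px
  lookupOr-∈ {i = suc i} (_ ∷ pxs) (s<s i<k) = lookupOr-∈ pxs i<k

  lookupOr-injective : ∀ {xs i j} → Unique xs → i < length xs → j < length xs →
                       lookupOr d xs i ≡ lookupOr d xs j → i ≡ j
  lookupOr-injective {i = zero}  {zero}  _        _         _         _  = refl
  lookupOr-injective {i = zero}  {suc j} (x∉ ∷ _) _         (s<s j<k) eq = ⊥-elim (lookupOr-∈ x∉ j<k eq)
  lookupOr-injective {i = suc i} {zero}  (x∉ ∷ _) (s<s i<k) _         eq = ⊥-elim (lookupOr-∈ x∉ i<k (sym eq))
  lookupOr-injective {i = suc i} {suc j} (_ ∷ u)  (s<s i<k) (s<s j<k) eq = cong suc (lookupOr-injective u i<k j<k eq)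

module _ {K : ℕ} (d : Pos K) where

  lookupOr-↝ : ∀ {W i} → Grounded W → suc i < length W → lookupOr d W i ↝ lookupOr d W (suc i)
  lookupOr-↝ {i = zero}  (p↝q ∷ _)  _         = p↝q
  lookupOr-↝ {i = suc i} (_ ∷ g)    (s<s i<k) = lookupOr-↝ g i<k
  lookupOr-↝             (landed _) (s<s ())

  lookupOr-last : ∀ {W i} → Grounded W → suc i ≡ length W → proj₂ (lookupOr d W i) ≡ 0
  lookupOr-last {i = zero}  (landed e) _   = e
  lookupOr-last {i = suc i} (_ ∷ g)    len = lookupOr-last g (suc-injective len)

grounded-applyUpTo : ∀ {K} (f : ℕ → Pos K) m → (∀ i → f i ↝ f (suc i)) → proj₂ (f m) ≡ 0 →
                     Grounded (applyUpTo f (suc m))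
grounded-applyUpTo f zero    _    last = landed last
grounded-applyUpTo f (suc m) step last = step 0 ∷ grounded-applyUpTo (f ∘ suc) m (step ∘ suc) last

record Orbit (n K : ℕ) : Set where
  field
    pos          : ℕ → Pos K
    pos-periodic : ∀ t → pos (t + n) ≡ pos t
    pos-step     : ∀ t → pos t ↝ pos (suc t)
    pos-distinct : ∀ s t → s < n → t < n → pos s ≡ pos t → s ≡ t
open Orbit public

unroll : ∀ {m K} W → CanonicalWindow (suc m) W → Orbit (suc m) K
unroll     []        (_ , _ , _ , ())
unroll {m} W@(p ∷ _) (len , u , g , _) = record
  { pos          = at
  ; pos-periodic = λ t → cong (lookupOr p W) ([m+n]%n≡m%n t n)
  ; pos-step     = at-step
  ; pos-distinct = λ s t s<n t<n eq → begin
      s       ≡⟨ m<n⇒m%n≡m s<n ⟨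
      s % n   ≡⟨ lookupOr-injective p u (in-window s) (in-window t) eq ⟩
      t % n   ≡⟨ m<n⇒m%n≡m t<n ⟩
      t       ∎
  }
  where
  open ≡-Reasoning
  n : ℕ
  n = suc m
  at : ℕ → Pos _
  at t = lookupOr p W (t % n)
  in-window : ∀ t → t % n < length W
  in-window t = subst (t % n <_) (sym len) (m%n<n t n)
  at-step : ∀ t → at t ↝ at (suc t)
  at-step t with suc (t % n) <? n
  ... | yes lt = subst (at t ↝_) (cong (lookupOr p W) (sym (suc-% n t lt)))
                       (lookupOr-↝ p g (subst (suc (t % n) <_) (sym len) lt))
  ... | no ¬lt = landed⇒↝ (lookupOr-last p g (trans (≤-antisym (m%n<n t n) (≮⇒≥ ¬lt)) (sym len)))

module OrbitProperties {m K : ℕ} (O : Orbit (suc m) K) where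

  private
    n : ℕ
    n = suc m

  pos-+* : ∀ x q → pos O (x + q * n) ≡ pos O x
  pos-+* x zero    = cong (pos O) (+-identityʳ x)
  pos-+* x (suc q) = begin
    pos O (x + (n + q * n))   ≡⟨ cong (pos O) (+-assoc x n (q * n)) ⟨
    pos O (x + n + q * n)     ≡⟨ cong (λ y → pos O (y + q * n)) (+-comm x n) ⟩
    pos O (n + x + q * n)     ≡⟨ cong (pos O) (+-assoc n x (q * n)) ⟩
    pos O (n + (x + q * n))   ≡⟨ cong (pos O) (+-comm n (x + q * n)) ⟩
    pos O (x + q * n + n)     ≡⟨ pos-periodic O (x + q * n) ⟩
    pos O (x + q * n)         ≡⟨ pos-+* x q ⟩
    pos O x                   ∎
    where open ≡-Reasoning

  pos-mod : ∀ t → pos O t ≡ pos O (t % n)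
  pos-mod t = trans (cong (pos O) (m≡m%n+[m/n]*n t n)) (pos-+* (t % n) (t / n))

  pos≡⇒%≡ : ∀ x y → pos O x ≡ pos O y → x % n ≡ y % n
  pos≡⇒%≡ x y eq =
    pos-distinct O (x % n) (y % n) (m%n<n x n) (m%n<n y n) (trans (sym (pos-mod x)) (trans eq (pos-mod y)))

  pos-shift : ∀ x y → pos O x ≡ pos O y → ∀ i → pos O (x + i) ≡ pos O (y + i)
  pos-shift x y eq i =
    trans (pos-mod (x + i)) (trans (cong (pos O) (%-cong-+ n x y i (pos≡⇒%≡ x y eq))) (sym (pos-mod (y + i))))

  pos-+% : ∀ x t → pos O (x + t % n) ≡ pos O (x + t)
  pos-+% x t = begin
    pos O (x + t % n)   ≡⟨ cong (pos O) (+-comm x (t % n)) ⟩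
    pos O (t % n + x)   ≡⟨ pos-shift (t % n) t (sym (pos-mod t)) x ⟩
    pos O (t + x)       ≡⟨ cong (pos O) (+-comm t x) ⟩
    pos O (x + t)       ∎
    where open ≡-Reasoning

  open import Data.List.Extrema (positionOrder K) using (argmin; f[argmin]≤f[xs]; argmin-all)

  opaque
    least : ℕ
    least = argmin (pos O) 0 (upTo n)

    least<n : least < n
    least<n = argmin-all (pos O) {P = _< n} z<s (All.applyUpTo⁺₁ (λ i → i) n (λ i<n → i<n))

    least-≤ₚ : ∀ t → pos O least ≤ₚ pos O t
    least-≤ₚ t = subst (pos O least ≤ₚ_) (sym (pos-mod t))
      (All.applyUpTo⁻ (λ i → i) n (f[argmin]≤f[xs] {f = pos O} 0 (upTo n)) (m%n<n t n))

  fromLeast : ℕ → Pos K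
  fromLeast i = pos O (least + i)

  window : List (Pos K)
  window = applyUpTo fromLeast n

  window-last-landed : proj₂ (fromLeast m) ≡ 0
  window-last-landed =
    ↝∧≤ₚ⇒landed (pos-step O (least + m)) (subst (_≤ₚ fromLeast m) returns (least-≤ₚ (least + m)))
    where
    returns : pos O least ≡ pos O (suc (least + m))
    returns = trans (sym (pos-periodic O least)) (cong (pos O) (+-suc least m))

  window-unique : Unique window
  window-unique = Unique.applyUpTo⁺₁ fromLeast n (λ {i} {j} i<j j<n eq →
    <⇒≢ i<j (+-%-cancelˡ n least (<-trans i<j j<n) j<n (pos≡⇒%≡ (least + i) (least + j) eq)))

  window-grounded : Grounded window
  window-grounded = grounded-applyUpTo fromLeast m
    (λ i → subst (fromLeast i ↝_) (cong (pos O) (sym (+-suc least i))) (pos-step O (least + i))) window-last-landed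

  window-headLeast : HeadLeast _≤ₚ_ window
  window-headLeast = All.applyUpTo⁺₂ (fromLeast ∘ suc) m
    (λ i → subst (_≤ₚ fromLeast (suc i)) (cong (pos O) (sym (+-identityʳ least))) (least-≤ₚ (least + suc i)))

  window-canonical : CanonicalWindow n window
  window-canonical = length-applyUpTo fromLeast n , window-unique , window-grounded , window-headLeast

  unroll-window : ∀ cw t → pos (unroll window cw) t ≡ pos O (least + t)
  unroll-window cw t = begin
    pos (unroll window cw) t                  ≡⟨⟩
    lookupOr (fromLeast 0) window (t % n)     ≡⟨ lookupOr-applyUpTo (fromLeast 0) fromLeast (m%n<n t n) ⟩
    fromLeast (t % n)                         ≡⟨ pos-+% least t ⟩
    pos O (least + t)                         ∎
    where open ≡-Reasoning

window-unroll : ∀ {m K} W (cw : CanonicalWindow (suc m) W) → OrbitProperties.window (unroll {m} {K} W cw) ≡ W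
window-unroll         []        (_ , _ , _ , ())
window-unroll {m} {K} W@(p ∷ _) cw@(len , _ , _ , p≤W) = begin
  applyUpTo (λ i → lookupOr p W ((least + i) % n)) n
    ≡⟨ applyUpTo-cong n (λ i i<n → cong (lookupOr p W) (least+i≡i i i<n)) ⟩
  applyUpTo (lookupOr p W) n                           ≡⟨ cong (applyUpTo (lookupOr p W)) len ⟨
  applyUpTo (lookupOr p W) (length W)                  ≡⟨ applyUpTo-lookupOr p W ⟩
  W                                                    ∎
  where
  open ≡-Reasoning
  n : ℕ
  n = suc m
  O : Orbit n K
  O = unroll W cw
  open OrbitProperties O using (least; least<n; least-≤ₚ)
  least≡0 : least ≡ 0
  least≡0 = pos-distinct O least 0 least<n z<s (≤ₚ-antisym (least-≤ₚ 0)
    (lookupOr-∈ p {P = p ≤ₚ_} (≤ₚ-refl ∷ p≤W) (subst (least % n <_) (sym len) (m%n<n least n))))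
  least+i≡i : ∀ i → i < n → (least + i) % n ≡ i
  least+i≡i i i<n = trans (cong (λ l → (l + i) % n) least≡0) (m<n⇒m%n≡m i<n)

module _ {m K : ℕ} (O O′ : Orbit (suc m) K) (r : ℕ) (rotated : ∀ t → pos O′ t ≡ pos O (t + r)) where

  private
    n : ℕ
    n = suc m
    module O  = OrbitProperties O
    module O′ = OrbitProperties O′

  window-rotate : O′.window ≡ O.window
  window-rotate = applyUpTo-cong n (λ i _ → begin
    pos O′ (O′.least + i)         ≡⟨ rotated (O′.least + i) ⟩
    pos O (O′.least + i + r)      ≡⟨ cong (pos O) (+-assoc O′.least i r) ⟩
    pos O (O′.least + (i + r))    ≡⟨ cong (λ x → pos O (O′.least + x)) (+-comm i r) ⟩
    pos O (O′.least + (r + i))    ≡⟨ cong (pos O) (+-assoc O′.least r i) ⟨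
    pos O (O′.least + r + i)      ≡⟨ O.pos-shift (O′.least + r) O.least same-least i ⟩
    pos O (O.least + i)           ∎)
    where
    open ≡-Reasoning
    -- Rotating back by r * n ∸ r shows that O is a rotation of O′ as well.
    unrotated : ∀ u → pos O′ (u + (r * n ∸ r)) ≡ pos O u
    unrotated u = begin
      pos O′ (u + (r * n ∸ r))      ≡⟨ rotated (u + (r * n ∸ r)) ⟩
      pos O (u + (r * n ∸ r) + r)   ≡⟨ cong (pos O) (+-assoc u (r * n ∸ r) r) ⟩
      pos O (u + (r * n ∸ r + r))   ≡⟨ cong (λ x → pos O (u + x)) (m∸n+n≡m (m≤m*n r n)) ⟩
      pos O (u + r * n)             ≡⟨ O.pos-+* u r ⟩
      pos O u                       ∎
    same-least : pos O (O′.least + r) ≡ pos O O.least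
    same-least = ≤ₚ-antisym
      (subst (_≤ₚ pos O O.least) (rotated O′.least)
             (subst (pos O′ O′.least ≤ₚ_) (unrotated O.least) (O′.least-≤ₚ (O.least + (r * n ∸ r)))))
      (O.least-≤ₚ (O′.least + r))

-- One-ball states as positions

≤sum-tabulate : ∀ {K} (f : Fin K → ℕ) i → f i ≤ sum (tabulate f)
≤sum-tabulate f zero    = m≤m+n (f zero) _
≤sum-tabulate f (suc i) = ≤-trans (≤sum-tabulate (f ∘ suc) i) (m≤n+m _ (f zero))

+≤sum-tabulate : ∀ {K} (f : Fin K → ℕ) {i i′} → i ≢ i′ → f i + f i′ ≤ sum (tabulate f)
+≤sum-tabulate f {zero}  {zero}   i≢i′ = ⊥-elim (i≢i′ refl)
+≤sum-tabulate f {zero}  {suc i′} _    = +-monoʳ-≤ (f zero) (≤sum-tabulate (f ∘ suc) i′)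
+≤sum-tabulate f {suc i} {zero}   _    =
  subst (_≤ sum (tabulate f)) (+-comm (f zero) (f (suc i))) (+-monoʳ-≤ (f zero) (≤sum-tabulate (f ∘ suc) i))
+≤sum-tabulate f {suc i} {suc i′} i≢i′ =
  ≤-trans (+≤sum-tabulate (f ∘ suc) (i≢i′ ∘ cong suc)) (m≤n+m _ (f zero))

sum-tabulate-positive : ∀ {K} (f : Fin K → ℕ) → 0 < sum (tabulate f) → Σ (Fin K) λ i → 0 < f i
sum-tabulate-positive {suc K} f pos with f zero in eq
... | suc _ = zero , subst (0 <_) (sym eq) z<s
... | zero  = let (i , 0<f) = sum-tabulate-positive (f ∘ suc) pos in suc i , 0<f

sum-tabulate-0 : ∀ K → sum (tabulate {n = K} (λ _ → 0)) ≡ 0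
sum-tabulate-0 zero    = refl
sum-tabulate-0 (suc K) = sum-tabulate-0 K

b2n-true : ∀ {b} → b ≡ true → b2n b ≡ 1
b2n-true refl = refl

m<1+n∧m≢n⇒m<n : ∀ {m n} → m < suc n → m ≢ n → m < n
m<1+n∧m≢n⇒m<n m<1+n m≢n = ≤∧≢⇒< (s≤s⁻¹ m<1+n) m≢n

rowCount-≥1 : ∀ r N {j} → j < N → r j ≡ true → 1 ≤ rowCount r N
rowCount-≥1 r (suc N) {j} j<1+N rj with j ≟ N
... | yes refl = subst (1 ≤_) (sym (cong (_+ rowCount r N) (b2n-true rj))) (s≤s z≤n)
... | no  j≢N  = ≤-trans (rowCount-≥1 r N (m<1+n∧m≢n⇒m<n j<1+N j≢N) rj) (m≤n+m _ _)

rowCount-≥2 : ∀ r N {j j′} → j < N → j′ < N → j ≢ j′ → r j ≡ true → r j′ ≡ true →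
              2 ≤ rowCount r N
rowCount-≥2 r (suc N) {j} {j′} j<1+N j′<1+N j≢j′ rj rj′ with j ≟ N | j′ ≟ N
... | yes refl | yes refl = ⊥-elim (j≢j′ refl)
... | yes refl | no j′≢N  = subst (2 ≤_) (sym (cong (_+ rowCount r N) (b2n-true rj)))
                               (s≤s (rowCount-≥1 r N (m<1+n∧m≢n⇒m<n j′<1+N j′≢N) rj′))
... | no j≢N   | yes refl = subst (2 ≤_) (sym (cong (_+ rowCount r N) (b2n-true rj′)))
                               (s≤s (rowCount-≥1 r N (m<1+n∧m≢n⇒m<n j<1+N j≢N) rj))
... | no j≢N   | no j′≢N  =
  ≤-trans (rowCount-≥2 r N (m<1+n∧m≢n⇒m<n j<1+N j≢N) (m<1+n∧m≢n⇒m<n j′<1+N j′≢N) j≢j′ rj rj′)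
          (m≤n+m _ _)

rowCount-positive : ∀ r N → 0 < rowCount r N → Σ ℕ λ j → r j ≡ true
rowCount-positive r (suc N) pos with r N in eq
... | true  = N , eq
... | false = rowCount-positive r N pos

rowCount-0 : ∀ r N → (∀ j → j < N → r j ≡ false) → rowCount r N ≡ 0
rowCount-0 r zero    _        = refl
rowCount-0 r (suc N) r≡false =
  cong₂ _+_ (cong b2n (r≡false N ≤-refl)) (rowCount-0 r N (λ j j<N → r≡false j (m<n⇒m<1+n j<N)))

module _ {K : ℕ} (A : State 1 K) where

  private
    row : Fin K → ℕ
    row i = rowCount (ball A i) (bound A)

    one-ball : sum (tabulate row) ≡ 1
    one-ball = trans (cong sum (sym (map-tabulate (λ i → i) row))) (total A)

    not-two : ¬ 2 ≤ sum (tabulate row)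
    not-two two with subst (2 ≤_) one-ball two
    ... | s≤s ()

    below-bound : ∀ {i j} → ball A i j ≡ true → j < bound A
    below-bound {i} {j} t with j <? bound A
    ... | yes j<b = j<b
    ... | no  j≮b with () ← trans (sym t) (beyond A i j (≮⇒≥ j≮b))

  ball-unique : ∀ {i j i′ j′} → ball A i j ≡ true → ball A i′ j′ ≡ true → (i , j) ≡ (i′ , j′)
  ball-unique {i} {j} {i′} {j′} t t′ with i Finₚ.≟ i′ | j ≟ j′
  ... | yes refl | yes refl = refl
  ... | yes refl | no j≢j′  = ⊥-elim (not-two (≤-trans
          (rowCount-≥2 (ball A i) (bound A) (below-bound t) (below-bound t′) j≢j′ t t′)
          (≤sum-tabulate row i)))
  ... | no i≢i′  | _        = ⊥-elim (not-two (≤-trans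
          (+-mono-≤ (rowCount-≥1 (ball A i) (bound A) (below-bound t) t)
                    (rowCount-≥1 (ball A i′) (bound A) (below-bound t′) t′))
          (+≤sum-tabulate row i≢i′)))

  private
    ball-found : Σ (Pos K) λ p → ball A (proj₁ p) (proj₂ p) ≡ true
    ball-found =
      let (i , 0<row) = sum-tabulate-positive row (subst (0 <_) (sym one-ball) z<s)
          (j , t)     = rowCount-positive (ball A i) (bound A) 0<row
      in (i , j) , t

  opaque
    position : Pos K
    position = proj₁ ball-found

    position-ball : ball A (proj₁ position) (proj₂ position) ≡ true
    position-ball = proj₂ ball-found

  ball⇒position : ∀ {i j} → ball A i j ≡ true → position ≡ (i , j)
  ball⇒position = ball-unique position-ball

position⇒ball : ∀ {K} (A : State 1 K) {i j} → position A ≡ (i , j) → ball A i j ≡ true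
position⇒ball A eq = subst (λ p → ball A (proj₁ p) (proj₂ p) ≡ true) eq (position-ball A)

module _ {K : ℕ} {A B : State 1 K} where

  ≈ₛ⇒position≡ : A ≈ₛ B → position A ≡ position B
  ≈ₛ⇒position≡ A≈B = sym (ball⇒position B (trans (sym (A≈B _ _)) (position-ball A)))

  position≡⇒≈ₛ : position A ≡ position B → A ≈ₛ B
  position≡⇒≈ₛ eq i j with ball A i j in tA | ball B i j in tB
  ... | true  | true  = refl
  ... | false | false = refl
  ... | true  | false with () ← trans (sym (position⇒ball B (trans (sym eq) (ball⇒position A tA)))) tB
  ... | false | true  with () ← trans (sym (position⇒ball A (trans eq (ball⇒position B tB)))) tA

  step-position : A ⟶ B → position A ↝ position B
  step-position A⟶B with position A in eq
  ... | (a , zero)  = throw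
  ... | (a , suc e) = subst ((a , suc e) ↝_) (sym (ball⇒position B (≤-true (A⟶B a e) (position⇒ball A eq)))) fall
    where
    ≤-true : ∀ {x y} → x Bool.≤ y → x ≡ true → y ≡ true
    ≤-true Bool.b≤b t = t
    ≤-true Bool.f≤t _ = refl

≡ᵇ-refl : ∀ n → (n ≡ᵇ n) ≡ true
≡ᵇ-refl zero    = refl
≡ᵇ-refl (suc n) = ≡ᵇ-refl n

≢⇒≡ᵇ-false : ∀ m n → m ≢ n → (m ≡ᵇ n) ≡ false
≢⇒≡ᵇ-false m n m≢n with m ≡ᵇ n in eq
... | true  = ⊥-elim (m≢n (≡ᵇ⇒≡ m n (subst T (sym eq) _)))
... | false = refl

sum-indicator : ∀ {K} (a : Fin K) → sum (tabulate {n = K} (λ i → b2n (toℕ i ≡ᵇ toℕ a))) ≡ 1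
sum-indicator {suc K} zero    = cong suc (sum-tabulate-0 K)
sum-indicator {suc K} (suc a) = sum-indicator a

rowCount-single : ∀ c e → rowCount (λ j → c ∧ (j ≡ᵇ e)) (suc e) ≡ b2n c
rowCount-single c e = begin
  b2n (c ∧ (e ≡ᵇ e)) + rowCount (λ j → c ∧ (j ≡ᵇ e)) e
    ≡⟨ cong₂ (λ x y → b2n (c ∧ x) + y) (≡ᵇ-refl e) (rowCount-0 _ e earlier) ⟩
  b2n (c ∧ true) + 0   ≡⟨ cong (λ x → b2n x + 0) (∧-identityʳ c) ⟩
  b2n c + 0            ≡⟨ +-identityʳ (b2n c) ⟩
  b2n c                ∎
  where
  open ≡-Reasoning
  earlier : ∀ j → j < e → c ∧ (j ≡ᵇ e) ≡ false
  earlier j j<e = trans (cong (c ∧_) (≢⇒≡ᵇ-false j e (<⇒≢ j<e))) (∧-zeroʳ c)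

state : ∀ {K} → Pos K → State 1 K
state {K} (a , e) = record
  { ball   = λ i j → hand i ∧ (j ≡ᵇ e)
  ; bound  = suc e
  ; beyond = λ i j e<j → trans (cong (hand i ∧_) (≢⇒≡ᵇ-false j e (≢-sym (<⇒≢ e<j)))) (∧-zeroʳ (hand i))
  ; total  = begin
      sum (map row (allFin K))             ≡⟨ cong sum (map-tabulate (λ i → i) row) ⟩
      sum (tabulate row)                   ≡⟨ cong sum (tabulate-cong (λ i → rowCount-single (hand i) e)) ⟩
      sum (tabulate (λ i → b2n (hand i)))  ≡⟨ sum-indicator a ⟩
      1                                    ∎
  }
  where
  open ≡-Reasoning
  hand : Fin K → Bool
  hand i = toℕ i ≡ᵇ toℕ a
  row : Fin K → ℕ
  row i = rowCount (λ j → hand i ∧ (j ≡ᵇ e)) (suc e)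

position-state : ∀ {K} (p : Pos K) → position (state p) ≡ p
position-state (a , e) = ball⇒position (state (a , e)) (cong₂ _∧_ (≡ᵇ-refl (toℕ a)) (≡ᵇ-refl e))

state-step : ∀ {K} {p q : Pos K} → p ↝ q → state p ⟶ state q
state-step fall  i j = Bool.b≤b
state-step throw i j = subst (Bool._≤ _) (sym (∧-zeroʳ _)) (≤-minimum _)

-- Prime patterns

toOrbit : ∀ {n K} → Cycle 1 n K → Orbit n K
toOrbit {n} c = record
  { pos          = λ t → position (st c t)
  ; pos-periodic = λ t → ≈ₛ⇒position≡ {A = st c (t + n)} {st c t} (periodic c t)
  ; pos-step     = λ t → step-position {A = st c t} {st c (suc t)} (step c t)
  ; pos-distinct = λ s t s<n t<n eq → distinct c s t s<n t<n (position≡⇒≈ₛ {A = st c s} {st c t} eq)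
  }

fromOrbit : ∀ {n K} → Orbit n K → Cycle 1 n K
fromOrbit {n} O = record
  { st       = λ t → state (pos O t)
  ; periodic = λ t → position≡⇒≈ₛ {A = state (pos O (t + n))} {state (pos O t)}
                       (cong (position ∘ state) (pos-periodic O t))
  ; step     = λ t → state-step (pos-step O t)
  ; distinct = λ s t s<n t<n eq → pos-distinct O s t s<n t<n (begin
      pos O s                      ≡⟨ position-state (pos O s) ⟨
      position (state (pos O s))   ≡⟨ ≈ₛ⇒position≡ {A = state (pos O s)} {state (pos O t)} eq ⟩
      position (state (pos O t))   ≡⟨ position-state (pos O t) ⟩
      pos O t                      ∎)
  }
  where open ≡-Reasoning

module _ {m K N : ℕ} (E : Enumeration (CanonicalWindow {K} (suc m)) N) where

  private
    n : ℕ
    n = suc m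

  listedCycle : Fin N → Cycle 1 n K
  listedCycle i = fromOrbit (unroll (enum E i) (enum-ok E i))

  windowOf : Cycle 1 n K → List (Pos K)
  windowOf c = OrbitProperties.window (toOrbit c)

  windowOf-fromOrbit : ∀ O → windowOf (fromOrbit O) ≡ OrbitProperties.window O
  windowOf-fromOrbit O = window-rotate O (toOrbit (fromOrbit O)) 0
    (λ t → trans (position-state (pos O t)) (cong (pos O) (sym (+-identityʳ t))))

  windowOf-listedCycle : ∀ i → windowOf (listedCycle i) ≡ enum E i
  windowOf-listedCycle i =
    trans (windowOf-fromOrbit (unroll (enum E i) (enum-ok E i))) (window-unroll (enum E i) (enum-ok E i))

  unrolled-window-rotates : ∀ c W (cw : CanonicalWindow n W) → W ≡ windowOf c → Rot (fromOrbit (unroll W cw)) c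
  unrolled-window-rotates c W cw refl = n ∸ least , λ t →
    position≡⇒≈ₛ {A = state (pos O′ (t + (n ∸ least)))} {st c t} (begin
      position (state (pos O′ (t + (n ∸ least))))   ≡⟨ position-state _ ⟩
      pos O′ (t + (n ∸ least))                      ≡⟨ unroll-window cw (t + (n ∸ least)) ⟩
      pos O (least + (t + (n ∸ least)))             ≡⟨ cong (pos O) (rearrange t) ⟩
      pos O (t + n)                                 ≡⟨ pos-periodic O t ⟩
      pos O t                                       ∎)
    where
    open ≡-Reasoning
    O O′ : Orbit n K
    O  = toOrbit c
    O′ = unroll W cw
    open OrbitProperties O using (least; least<n; unroll-window)
    rearrange : ∀ t → least + (t + (n ∸ least)) ≡ t + n
    rearrange t = begin
      least + (t + (n ∸ least))   ≡⟨ +-assoc least t (n ∸ least) ⟨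
      least + t + (n ∸ least)     ≡⟨ cong (_+ (n ∸ least)) (+-comm least t) ⟩
      t + least + (n ∸ least)     ≡⟨ +-assoc t least (n ∸ least) ⟩
      t + (least + (n ∸ least))   ≡⟨ cong (t +_) (m+[n∸m]≡n (<⇒≤ least<n)) ⟩
      t + n                       ∎

  every-cycle-listed : ∀ c → Σ (Fin N) λ i → Rot (listedCycle i) c
  every-cycle-listed c =
    index E W cw , unrolled-window-rotates c (enum E (index E W cw)) (enum-ok E _) (enum-index E W cw)
    where
    W : List (Pos K)
    W = windowOf c
    cw : CanonicalWindow n W
    cw = OrbitProperties.window-canonical (toOrbit c)

  listed-once : ∀ i j → Rot (listedCycle i) (listedCycle j) → i ≡ j
  listed-once i j (r , rot) = enum-injective E i j (begin
    enum E i                  ≡⟨ windowOf-listedCycle i ⟨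
    windowOf (listedCycle i)  ≡⟨ window-rotate (toOrbit (listedCycle i)) (toOrbit (listedCycle j)) r rotated ⟨
    windowOf (listedCycle j)  ≡⟨ windowOf-listedCycle j ⟩
    enum E j                  ∎)
    where
    open ≡-Reasoning
    rotated : ∀ t → pos (toOrbit (listedCycle j)) t ≡ pos (toOrbit (listedCycle i)) (t + r)
    rotated t = sym (≈ₛ⇒position≡ {A = st (listedCycle i) (t + r)} {st (listedCycle j) t} (rot t))

  primePatternCount : PrimePatternCount 1 n K N
  primePatternCount = listedCycle , every-cycle-listed , listed-once

theorem5p1 : ∀ (n k : ℕ) → 1 ≤ n → 1 ≤ k → PrimePatternCount 1 n k (formula n k)
theorem5p1 (suc m) k _ _ = primePatternCount (canonicalWindowEnumeration m k)
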